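{- Let $G$ be a subcubic class two graph. Then $$K_G=\bigcup\{R : R \text{ is a representative conflicting subset of } G \text{ of minimal order}\},$$ where "of minimal order" means that $|R|$ is the minimum cardinality among all representative conflicting subsets of $G$.
   Context: All graphs are finite. A graph is subcubic if every vertex has degree at most 3; a subcubic graph is class two if it has no proper 3-edge-colouring (hence it has a proper 4-edge-colouring, with colours taken from $\{0,1,2,3\}$). The resistance $r(G)$ is the minimum, over all proper 4-edge-colourings $f$ of $G$ and colours $i$, of $|f^{ -1}(i)|$. A minimal colouring of $G$ is a proper 4-edge-colouring $f$ with $|f^{ -1}(0)|=r(G)$. The critical subgraph of $G$ is $K_G=\{e\in E(G) : f(e)=0 \text{ for some minimal colouring } f \text{ of } G\}$. A conflicting subgraph of $G$ is a subgraph admitting no proper 3-edge-colouring; it is a minimal conflicting subgraph if removing any one of its edges yields a 3-edge-colourable graph. If $M_1,\dots,M_r$ are all minimal conflicting subgraphs of $G$, a representative conflicting subset of $G$ is a set $R\subseteq E(G)$ with $R\cap E(M_i)\neq\emptyset$ for each $i$. -}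

module Defs where

open import Data.Nat using (ℕ; _≤_)
open import Data.Fin using (Fin; _≟_)
open import Data.Fin.Subset using (Subset; _∈_; _∉_; ∣_∣; ⊤; _∩_; Nonempty; ⁅_⁆; _─_)
open import Data.Vec using (tabulate)
open import Data.Product using (Σ; _×_; _,_; proj₁; proj₂; ∃)
open import Data.Sum using (_⊎_)
open import Relation.Binary.PropositionalEquality using (_≡_; _≢_)
open import Relation.Nullary using (¬_; does)

record Graph : Set where
  field
    n        : ℕ
    m        : ℕ
    ends     : Fin m → Fin n × Fin n
    loopless : ∀ e → proj₁ (ends e) ≢ proj₂ (ends e)

module _ (G : Graph) where
  open Graph G

  Incident : Fin n → Fin m → Set
  Incident v e = (v ≡ proj₁ (ends e)) ⊎ (v ≡ proj₂ (ends e))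

  Adjacent : Fin m → Fin m → Set
  Adjacent e e' = ∃ λ v → Incident v e × Incident v e'

  degree : Fin n → ℕ
  degree v = ∣ tabulate (λ e → does (v ≟ proj₁ (ends e)) Data.Bool.∨ does (v ≟ proj₂ (ends e))) ∣
    where import Data.Bool

  Subcubic : Set
  Subcubic = ∀ v → degree v ≤ 3

  ProperOn : (k : ℕ) → Subset m → (Fin m → Fin k) → Set
  ProperOn k S c = ∀ e e' → e ≢ e' → e ∈ S → e' ∈ S → Adjacent e e' → c e ≢ c e'

  Colourable : ℕ → Subset m → Set
  Colourable k S = ∃ λ (c : Fin m → Fin k) → ProperOn k S c

  Proper : (k : ℕ) → (Fin m → Fin k) → Set
  Proper k c = ProperOn k ⊤ c

  ClassTwo : Set
  ClassTwo = ¬ Colourable 3 ⊤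

  colourClass : {k : ℕ} → (Fin m → Fin k) → Fin k → Subset m
  colourClass f i = tabulate (λ e → does (f e ≟ i))

  -- f is a minimal colouring: a proper 4-edge-colouring with |f⁻¹(0)| = r(G),
  -- i.e. |f⁻¹(0)| ≤ |g⁻¹(i)| for every proper 4-edge-colouring g and colour i
  MinimalColouring : (Fin m → Fin 4) → Set
  MinimalColouring f =
    Proper 4 f ×
    (∀ (g : Fin m → Fin 4) → Proper 4 g → ∀ i →
       ∣ colourClass f Fin.zero ∣ ≤ ∣ colourClass g i ∣)
    where import Data.Fin as Fin

  InCritical : Fin m → Set
  InCritical e = ∃ λ (f : Fin m → Fin 4) → MinimalColouring f × f e ≡ Data.Fin.zero
    where import Data.Fin

  -- conflicting subgraphs (represented by their edge sets)
  Conflicting : Subset m → Set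
  Conflicting S = ¬ Colourable 3 S

  MinimalConflicting : Subset m → Set
  MinimalConflicting S = Conflicting S × (∀ e → e ∈ S → Colourable 3 (S ─ ⁅ e ⁆))

  RepresentativeConflicting : Subset m → Set
  RepresentativeConflicting R = ∀ S → MinimalConflicting S → Nonempty (R ∩ S)

  MinimumRepresentative : Subset m → Set
  MinimumRepresentative R =
    RepresentativeConflicting R × (∀ R' → RepresentativeConflicting R' → ∣ R ∣ ≤ ∣ R' ∣)

{-# OPTIONS --safe #-}
module Submission where

-- An edge set R is representative iff G - R is 3-edge-colourable, so the colour classes of
-- proper 4-edge-colourings are representative, and a representative set of minimum order is
-- one colour class of a minimal colouring once we know it is a matching.  That is the heart of
-- the proof: if R is representative but no R - e is, and two edges e = uv, e' = uw of R meet
-- at u, then every colour of a 3-edge-colouring c of G - R appears next to e and next to e'.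
-- As G is subcubic this forces a single edge g of G - R at u, of colour a say, and colours b
-- and d at v and at w, while a is missing at v and at w.  The (a,b)-Kempe chain starting at v
-- must pass through g (otherwise swapping it frees b at both ends of e), so it is the path
-- ending at u; likewise for w, and a path has only one other end, so v = w, which leaves four
-- edges at v.

open import Defs
open import Data.Bool using (Bool; true; false; _∨_)
open import Data.Bool.Properties using (∨-zeroʳ)
open import Data.Empty using (⊥; ⊥-elim)
open import Data.Fin using (Fin; zero; suc; _≟_; punchIn; punchOut)
import Data.Fin.Properties as Finₚ
open import Data.Fin.Subset using (Subset; _∈_; ∣_∣; _∩_; _-_; ∁; _⊆_)
import Data.Fin.Subset.Properties as Subsetₚ
open import Data.Nat using (zero; suc; _≤_; _<_; z≤n; s≤s)
import Data.Nat.Properties as ℕₚ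
open import Data.Product using (_×_; _,_; proj₁; proj₂; ∃)
open import Data.Sum using (_⊎_; inj₁; inj₂)
open import Data.Vec using (Vec; []; _∷_; lookup; tabulate)
import Data.Vec.Properties as Vecₚ
open import Function using (_∘_; id)
open import Function.Bundles using (_⇔_; mk⇔)
open import Relation.Nullary using (¬_; Dec; yes; no; does)
open import Relation.Nullary.Decidable
  using (_×-dec_; _⊎-dec_; _→-dec_; ¬?; map′; decidable-stable; dec-true; ¬¬-excluded-middle)
open import Relation.Binary.PropositionalEquality
  using (_≡_; _≢_; refl; sym; trans; cong; cong₂; subst; ≢-sym)

any-Vec? : ∀ {k} m {P : Vec (Fin k) m → Set} → (∀ v → Dec (P v)) → Dec (∃ P)
any-Vec? zero    P? = map′ ([] ,_) (λ { ([] , p) → p }) (P? [])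
any-Vec? (suc m) P? = map′ (λ (x , v , p) → x ∷ v , p) (λ { (x ∷ v , p) → x , v , p })
                           (Finₚ.any? λ x → any-Vec? m (P? ∘ (x ∷_)))

¬¬-decide-all : ∀ {m} (P : Fin m → Set) → ¬ ¬ (∀ y → Dec (P y))
¬¬-decide-all {zero}  P k = k λ ()
¬¬-decide-all {suc m} P k = ¬¬-excluded-middle λ P₀? → ¬¬-decide-all (P ∘ suc) λ Pₛ? →
  k λ { zero → P₀? ; (suc y) → Pₛ? y }

∈-tabulate⁺ : ∀ {m} (p : Fin m → Bool) {x} → p x ≡ true → x ∈ tabulate p
∈-tabulate⁺ p {x} px = Vecₚ.lookup⇒[]= x (tabulate p) (trans (Vecₚ.lookup∘tabulate p x) px)

∈-tabulate⁻ : ∀ {m} (p : Fin m → Bool) {x} → x ∈ tabulate p → p x ≡ true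
∈-tabulate⁻ p {x} x∈ = trans (sym (Vecₚ.lookup∘tabulate p x)) (Vecₚ.[]=⇒lookup x∈)

¬four-distinct-∈ : ∀ {m} {D : Subset m} → ∣ D ∣ ≤ 3 → ∀ {x₁ x₂ x₃ x₄} →
  x₁ ∈ D → x₂ ∈ D → x₃ ∈ D → x₄ ∈ D →
  x₁ ≢ x₂ → x₁ ≢ x₃ → x₁ ≢ x₄ → x₂ ≢ x₃ → x₂ ≢ x₄ → x₃ ≢ x₄ → ⊥
¬four-distinct-∈ ∣D∣≤3 x₁∈ x₂∈ x₃∈ x₄∈ x₁≢x₂ x₁≢x₃ x₁≢x₄ x₂≢x₃ x₂≢x₄ x₃≢x₄ =
  ℕₚ.≤⇒≯ ∣D∣≤3 (shrink (shrink (shrink (shrink z≤n x₄∈′) x₃∈′) x₂∈′) x₁∈)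
  where
    shrink : ∀ {m} {p : Subset m} {x k} → k ≤ ∣ p - x ∣ → x ∈ p → suc k ≤ ∣ p ∣
    shrink k≤ x∈ = ℕₚ.≤-trans (s≤s k≤) (Subsetₚ.x∈p⇒∣p-x∣<∣p∣ x∈)
    x₂∈′ = Subsetₚ.x∈p∧x≢y⇒x∈p-y x₂∈ (≢-sym x₁≢x₂)
    x₃∈′ = Subsetₚ.x∈p∧x≢y⇒x∈p-y (Subsetₚ.x∈p∧x≢y⇒x∈p-y x₃∈ (≢-sym x₁≢x₃)) (≢-sym x₂≢x₃)
    x₄∈′ = Subsetₚ.x∈p∧x≢y⇒x∈p-y (Subsetₚ.x∈p∧x≢y⇒x∈p-y
             (Subsetₚ.x∈p∧x≢y⇒x∈p-y x₄∈ (≢-sym x₁≢x₄)) (≢-sym x₂≢x₄)) (≢-sym x₃≢x₄)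

Irreducible : ∀ {m} → (Subset m → Set) → Subset m → Set
Irreducible P S = P S × (∀ e → e ∈ S → ¬ P (S - e))

irreducible-⊆ : ∀ {m} {P : Subset m → Set} → (∀ S → Dec (P S)) →
  ∀ {T} → P T → ∃ λ S → S ⊆ T × Irreducible P S
irreducible-⊆ {P = P} P? {T} PT = go (suc ∣ T ∣) ℕₚ.≤-refl PT
  where
    go : ∀ k {T} → ∣ T ∣ < k → P T → ∃ λ S → S ⊆ T × Irreducible P S
    go (suc k) {T} ∣T∣<k PT with Finₚ.any? (λ e → (e Subsetₚ.∈? T) ×-dec P? (T - e))
    ... | no ¬removable = T , id , PT , λ e e∈T PT-e → ¬removable (e , e∈T , PT-e)
    ... | yes (e , e∈T , PT-e) =
      let S , S⊆T-e , S-irreducible =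
            go k (ℕₚ.<-≤-trans (Subsetₚ.x∈p⇒∣p-x∣<∣p∣ e∈T) (ℕₚ.≤-pred ∣T∣<k)) PT-e
      in S , Subsetₚ.p─q⊆p T _ ∘ S⊆T-e , S-irreducible

-- Renumbers the colours other than i; the value at i itself is junk.
collapse : ∀ {k} → Fin (suc (suc k)) → Fin (suc (suc k)) → Fin (suc k)
collapse i j with j ≟ i
... | yes _   = zero
... | no  j≢i = punchOut (≢-sym j≢i)

collapse-injective : ∀ {k} {i j j′ : Fin (suc (suc k))} → j ≢ i → j′ ≢ i →
  collapse i j ≡ collapse i j′ → j ≡ j′
collapse-injective {i = i} {j} {j′} j≢i j′≢i eq with j ≟ i | j′ ≟ i
... | yes j≡i | _        = ⊥-elim (j≢i j≡i)
... | no _    | yes j′≡i = ⊥-elim (j′≢i j′≡i)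
... | no j≢i′ | no j′≢i′ = Finₚ.punchOut-injective (≢-sym j≢i′) (≢-sym j′≢i′) eq

module _ (G : Graph) where
  open Graph G

  incident? : ∀ v e → Dec (Incident G v e)
  incident? v e = (v ≟ proj₁ (ends e)) ⊎-dec (v ≟ proj₂ (ends e))

  adjacent? : ∀ e e′ → Dec (Adjacent G e e′)
  adjacent? e e′ = Finₚ.any? λ v → incident? v e ×-dec incident? v e′

  adjacent-sym : ∀ {e e′} → Adjacent G e e′ → Adjacent G e′ e
  adjacent-sym (v , v-e , v-e′) = v , v-e′ , v-e

  properOn? : ∀ {k} S (c : Fin m → Fin k) → Dec (ProperOn G k S c)
  properOn? S c = Finₚ.all? λ e → Finₚ.all? λ e′ →
    ¬? (e ≟ e′) →-dec (e Subsetₚ.∈? S) →-dec (e′ Subsetₚ.∈? S) →-dec adjacent? e e′ →-dec ¬? (c e ≟ c e′)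

  properOn-cong : ∀ {k S} {c c′ : Fin m → Fin k} → (∀ e → c e ≡ c′ e) →
    ProperOn G k S c → ProperOn G k S c′
  properOn-cong c≗c′ c-proper e e′ e≢e′ e∈S e′∈S adj =
    c-proper e e′ e≢e′ e∈S e′∈S adj ∘ λ eq → trans (c≗c′ e) (trans eq (sym (c≗c′ e′)))

  colourable-⊆ : ∀ {k S S′} → S ⊆ S′ → Colourable G k S′ → Colourable G k S
  colourable-⊆ S⊆S′ (c , c-proper) = c , λ e e′ e≢e′ e∈S e′∈S → c-proper e e′ e≢e′ (S⊆S′ e∈S) (S⊆S′ e′∈S)

  colourable? : ∀ {k} S → Dec (Colourable G k S)
  colourable? S =
    map′ (λ (v , proper) → lookup v , proper)
         (λ (c , proper) → tabulate c , properOn-cong (λ e → sym (Vecₚ.lookup∘tabulate c e)) proper)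
         (any-Vec? m (properOn? S ∘ lookup))

  ColourableWithout : Subset m → Set
  ColourableWithout R = Colourable G 3 (∁ R)

  Matching : Subset m → Set
  Matching R = ∀ e e′ → e ≢ e′ → e ∈ R → e′ ∈ R → ¬ Adjacent G e e′

  colourableWithout⇒representative : ∀ {R} → ColourableWithout R → RepresentativeConflicting G R
  colourableWithout⇒representative {R} ∁R-colourable S (S-conflicting , _) =
    decidable-stable (Subsetₚ.nonempty? (R ∩ S)) λ R∩S-empty →
      S-conflicting (colourable-⊆ (λ x∈S → Subsetₚ.x∉p⇒x∈∁p λ x∈R →
        R∩S-empty (_ , Subsetₚ.x∈p∩q⁺ (x∈R , x∈S))) ∁R-colourable)

  representative⇒colourableWithout : ∀ {R} → RepresentativeConflicting G R → ColourableWithout R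
  representative⇒colourableWithout {R} R-representative =
    decidable-stable (colourable? (∁ R)) λ ∁R-conflicting →
      let S , S⊆∁R , S-conflicting , S-critical = irreducible-⊆ (¬? ∘ colourable?) ∁R-conflicting
          x , x∈R∩S = R-representative S
            (S-conflicting , λ e e∈S → decidable-stable (colourable? _) (S-critical e e∈S))
          x∈R , x∈S = Subsetₚ.x∈p∩q⁻ R S x∈R∩S
      in Subsetₚ.x∈p⇒x∉∁p x∈R (S⊆∁R x∈S)

  ∈colourClass⁺ : ∀ {k} {f : Fin m → Fin k} {i e} → f e ≡ i → e ∈ colourClass G f i
  ∈colourClass⁺ {f = f} {i} {e} fe≡i = ∈-tabulate⁺ (λ x → does (f x ≟ i)) (dec-true (f e ≟ i) fe≡i)

  ∈colourClass⁻ : ∀ {k} {f : Fin m → Fin k} {i e} → e ∈ colourClass G f i → f e ≡ i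
  ∈colourClass⁻ {f = f} {i} {e} e∈ with f e ≟ i | ∈-tabulate⁻ (λ x → does (f x ≟ i)) e∈
  ... | yes fe≡i | _ = fe≡i
  ... | no _     | ()

  ∁colourClass-colourable : ∀ {f} → Proper G 4 f → ∀ i → ColourableWithout (colourClass G f i)
  ∁colourClass-colourable {f} f-proper i = collapse i ∘ f , λ x x′ x≢x′ x∈ x′∈ adj →
    f-proper x x′ x≢x′ Subsetₚ.∈⊤ Subsetₚ.∈⊤ adj ∘ collapse-injective (≢i x∈) (≢i x′∈)
    where
      ≢i : ∀ {x} → x ∈ ∁ (colourClass G f i) → f x ≢ i
      ≢i x∈ = Subsetₚ.x∈∁p⇒x∉p x∈ ∘ ∈colourClass⁺ {f = f}

  extend : Subset m → (Fin m → Fin 3) → Fin m → Fin 4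
  extend R c x with x Subsetₚ.∈? R
  ... | yes _ = zero
  ... | no  _ = suc (c x)

  extend-proper : ∀ {R c} → Matching R → ProperOn G 3 (∁ R) c → Proper G 4 (extend R c)
  extend-proper {R} R-matching c-proper x x′ x≢x′ _ _ adj with x Subsetₚ.∈? R | x′ Subsetₚ.∈? R
  ... | yes x∈R | yes x′∈R = λ _ → R-matching x x′ x≢x′ x∈R x′∈R adj
  ... | yes _   | no  _    = λ ()
  ... | no  _   | yes _    = λ ()
  ... | no  x∉R | no  x′∉R =
    c-proper x x′ x≢x′ (Subsetₚ.x∉p⇒x∈∁p x∉R) (Subsetₚ.x∉p⇒x∈∁p x′∉R) adj ∘ Finₚ.suc-injective

  colourClass-extend : ∀ R c → colourClass G (extend R c) zero ≡ R
  colourClass-extend R c = trans (Vecₚ.tabulate-cong in-R) (Vecₚ.tabulate∘lookup R)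
    where
      in-R : ∀ x → does (extend R c x ≟ zero) ≡ lookup R x
      in-R x with x Subsetₚ.∈? R
      ... | yes x∈R = sym (Vecₚ.[]=⇒lookup x∈R)
      ... | no  x∉R with lookup R x in eq
      ...   | true  = ⊥-elim (x∉R (Vecₚ.lookup⇒[]= x R eq))
      ...   | false = refl

  minimum⇒irreducible : ∀ {R} → MinimumRepresentative G R → Irreducible ColourableWithout R
  minimum⇒irreducible (R-representative , R-minimum) =
    representative⇒colourableWithout R-representative , λ e e∈R ∁[R-e]-colourable →
      ℕₚ.<⇒≱ (Subsetₚ.x∈p⇒∣p-x∣<∣p∣ e∈R)
             (R-minimum _ (colourableWithout⇒representative ∁[R-e]-colourable))

  edgesAt : Fin n → Subset m
  edgesAt v = tabulate λ e → does (v ≟ proj₁ (ends e)) ∨ does (v ≟ proj₂ (ends e))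

  incident⇒∈edgesAt : ∀ {v e} → Incident G v e → e ∈ edgesAt v
  incident⇒∈edgesAt {v} {e} v-e = ∈-tabulate⁺ _ (incident v-e)
    where
      incident : Incident G v e → (does (v ≟ proj₁ (ends e)) ∨ does (v ≟ proj₂ (ends e))) ≡ true
      incident (inj₁ v≡) = cong (_∨ does (v ≟ proj₂ (ends e))) (dec-true (v ≟ _) v≡)
      incident (inj₂ v≡) = trans (cong (does (v ≟ _) ∨_) (dec-true (v ≟ _) v≡)) (∨-zeroʳ _)

  ¬four-incident : Subcubic G → ∀ {v y₁ y₂ y₃ y₄} →
    Incident G v y₁ → Incident G v y₂ → Incident G v y₃ → Incident G v y₄ →
    y₁ ≢ y₂ → y₁ ≢ y₃ → y₁ ≢ y₄ → y₂ ≢ y₃ → y₂ ≢ y₄ → y₃ ≢ y₄ → ⊥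
  ¬four-incident subcubic {v} v-y₁ v-y₂ v-y₃ v-y₄ =
    ¬four-distinct-∈ (subcubic v) (incident⇒∈edgesAt v-y₁) (incident⇒∈edgesAt v-y₂)
                                  (incident⇒∈edgesAt v-y₃) (incident⇒∈edgesAt v-y₄)

  record Joins (e : Fin m) (u v : Fin n) : Set where
    field
      incident  : Incident G v e
      distinct  : v ≢ u
      endpoints : ∀ z → Incident G z e → z ≡ u ⊎ z ≡ v

  other-end : ∀ {u e} → Incident G u e → ∃ (Joins e u)
  other-end {e = e} (inj₁ refl) = proj₂ (ends e) , record
    { incident = inj₂ refl ; distinct = loopless e ∘ sym ; endpoints = λ _ z-e → z-e }
  other-end {e = e} (inj₂ refl) = proj₁ (ends e) , record
    { incident = inj₁ refl ; distinct = loopless e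
    ; endpoints = λ { _ (inj₁ p) → inj₂ p ; _ (inj₂ p) → inj₁ p } }

  same-colour⇒≡ : ∀ {S c} → ProperOn G 3 S c → ∀ {z y y′} → y ∈ S → y′ ∈ S →
    Incident G z y → Incident G z y′ → c y ≡ c y′ → y ≡ y′
  same-colour⇒≡ c-proper {z} {y} {y′} y∈S y′∈S z-y z-y′ cy≡cy′ =
    decidable-stable (y ≟ y′) λ y≢y′ → c-proper y y′ y≢y′ y∈S y′∈S (z , z-y , z-y′) cy≡cy′

open Joins

module Transposition {k} (a b : Fin k) (a≢b : a ≢ b) where

  swap : Fin k → Fin k
  swap x with x ≟ a | x ≟ b
  ... | yes _ | _     = b
  ... | no _  | yes _ = a
  ... | no _  | no _  = x

  swap-cases : ∀ x → (x ≡ a × swap x ≡ b) ⊎ (x ≡ b × swap x ≡ a) ⊎ (x ≢ a × x ≢ b × swap x ≡ x)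
  swap-cases x with x ≟ a | x ≟ b
  ... | yes x≡a | _       = inj₁ (x≡a , refl)
  ... | no _    | yes x≡b = inj₂ (inj₁ (x≡b , refl))
  ... | no x≢a  | no x≢b  = inj₂ (inj₂ (x≢a , x≢b , refl))

  swap-a : swap a ≡ b
  swap-a with swap-cases a
  ... | inj₁ (_ , swap-a≡b)       = swap-a≡b
  ... | inj₂ (inj₁ (a≡b , _))     = ⊥-elim (a≢b a≡b)
  ... | inj₂ (inj₂ (a≢a , _ , _)) = ⊥-elim (a≢a refl)

  swap-b : swap b ≡ a
  swap-b with swap-cases b
  ... | inj₁ (b≡a , _)            = ⊥-elim (a≢b (sym b≡a))
  ... | inj₂ (inj₁ (_ , swap-b≡a)) = swap-b≡a
  ... | inj₂ (inj₂ (_ , b≢b , _)) = ⊥-elim (b≢b refl)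

  swap-involutive : ∀ x → swap (swap x) ≡ x
  swap-involutive x with swap-cases x
  ... | inj₁ (refl , swap-a≡b)       = trans (cong swap swap-a≡b) swap-b
  ... | inj₂ (inj₁ (refl , swap-b≡a)) = trans (cong swap swap-b≡a) swap-a
  ... | inj₂ (inj₂ (_ , _ , swap-x≡x)) = trans (cong swap swap-x≡x) swap-x≡x

  swap-sym : ∀ {x y} → swap x ≡ y → x ≡ swap y
  swap-sym {x} swap-x≡y = trans (sym (swap-involutive x)) (cong swap swap-x≡y)

  swap-injective : ∀ {x y} → swap x ≡ swap y → x ≡ y
  swap-injective {y = y} eq = trans (swap-sym eq) (swap-involutive y)

  OneOf : Fin k → Set
  OneOf x = x ≡ a ⊎ x ≡ b

  swap-OneOf : ∀ {x} → OneOf x → OneOf (swap x)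
  swap-OneOf (inj₁ refl) = inj₂ swap-a
  swap-OneOf (inj₂ refl) = inj₁ swap-b

  OneOf-≢⇒swap : ∀ {x y} → OneOf x → OneOf y → x ≢ y → y ≡ swap x
  OneOf-≢⇒swap (inj₁ refl) (inj₁ refl) x≢y = ⊥-elim (x≢y refl)
  OneOf-≢⇒swap (inj₁ refl) (inj₂ refl) _   = sym swap-a
  OneOf-≢⇒swap (inj₂ refl) (inj₁ refl) _   = sym swap-b
  OneOf-≢⇒swap (inj₂ refl) (inj₂ refl) x≢y = ⊥-elim (x≢y refl)

-- The (a,b)-Kempe chain of c is traversed as a walk on states (z , k): "at z, about to
-- leave along the edge of T of colour k".  Steps alternate the two colours and are
-- determined by their target, so a walk is determined by its last state and its first
-- state has no predecessor when the colour a is missing there.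
module KempeChain (G : Graph) (T : Subset (Graph.m G)) (c : Fin (Graph.m G) → Fin 3)
                  (c-proper : ProperOn G 3 T c) (a b : Fin 3) (a≢b : a ≢ b) where
  open Graph G
  open Transposition a b a≢b

  State : Set
  State = Fin n × Fin 3

  _exitsBy_ : State → Fin m → Set
  s exitsBy y = y ∈ T × Incident G (proj₁ s) y × c y ≡ proj₂ s

  _⟶_ : State → State → Set
  s ⟶ s′ = proj₂ s′ ≡ swap (proj₂ s) × ∃ λ y → s exitsBy y × Joins G y (proj₁ s) (proj₁ s′)

  data _⟶*_ (s : State) : State → Set where
    ε   : s ⟶* s
    _▷_ : ∀ {t t′} → s ⟶* t → t ⟶ t′ → s ⟶* t′

  Chain : State → Fin m → Set
  Chain s y = ∃ λ t → s ⟶* t × t exitsBy y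

  Initial : State → Set
  Initial s = ∀ t → ¬ t ⟶ s

  MissingAt : Fin n → Set
  MissingAt v = ∀ y → y ∈ T → Incident G v y → c y ≢ a

  ⟶-injective : ∀ {s₁ s₂ t} → s₁ ⟶ t → s₂ ⟶ t → s₁ ≡ s₂
  ⟶-injective {z₁ , k₁} {z₂ , k₂} (k≡₁ , y₁ , (y₁∈T , _ , cy₁≡k₁) , y₁-joins)
                                  (k≡₂ , y₂ , (y₂∈T , z₂-y₂ , cy₂≡k₂) , y₂-joins) =
    cong₂ _,_ z₁≡z₂ k₁≡k₂
    where
      k₁≡k₂ : k₁ ≡ k₂
      k₁≡k₂ = swap-injective (trans (sym k≡₁) k≡₂)
      y₁≡y₂ : y₁ ≡ y₂
      y₁≡y₂ = same-colour⇒≡ G c-proper y₁∈T y₂∈T (incident y₁-joins) (incident y₂-joins)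
                (trans cy₁≡k₁ (trans k₁≡k₂ (sym cy₂≡k₂)))
      z₁≡z₂ : z₁ ≡ z₂
      z₁≡z₂ with endpoints y₁-joins z₂ (subst (Incident G z₂) (sym y₁≡y₂) z₂-y₂)
      ... | inj₁ z₂≡z₁ = sym z₂≡z₁
      ... | inj₂ z₂≡z′ = ⊥-elim (distinct y₂-joins (sym z₂≡z′))

  last-step : ∀ {s t} → s ⟶* t → t ≡ s ⊎ ∃ λ t′ → s ⟶* t′ × t′ ⟶ t
  last-step ε             = inj₁ refl
  last-step (walk ▷ step) = inj₂ (_ , walk , step)

  initial-unique : ∀ {s₁ s₂ t} → Initial s₁ → Initial s₂ → s₁ ⟶* t → s₂ ⟶* t → s₁ ≡ s₂
  initial-unique _          _          ε           ε           = refl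
  initial-unique s₁-initial _          ε           (_ ▷ step₂) = ⊥-elim (s₁-initial _ step₂)
  initial-unique _          s₂-initial (_ ▷ step₁) ε           = ⊥-elim (s₂-initial _ step₁)
  initial-unique s₁-initial s₂-initial (walk₁ ▷ step₁) (walk₂ ▷ step₂)
    with ⟶-injective step₁ step₂
  ... | refl = initial-unique s₁-initial s₂-initial walk₁ walk₂

  walk-OneOf : ∀ {s t} → OneOf (proj₂ s) → s ⟶* t → OneOf (proj₂ t)
  walk-OneOf s-colour ε                  = s-colour
  walk-OneOf s-colour (walk ▷ (k′≡ , _)) = subst OneOf (sym k′≡) (swap-OneOf (walk-OneOf s-colour walk))

  chain-OneOf : ∀ {s y} → OneOf (proj₂ s) → Chain s y → OneOf (c y)
  chain-OneOf s-colour (_ , walk , (_ , _ , cy≡k)) = subst OneOf (sym cy≡k) (walk-OneOf s-colour walk)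

  module _ {v : Fin n} (a-missing : MissingAt v) where

    initial : Initial (v , b)
    initial _ (b≡ , y , (y∈T , _ , cy≡k) , y-joins) =
      a-missing y y∈T (incident y-joins) (trans cy≡k (trans (swap-sym (sym b≡)) swap-b))

    chain-closed : ∀ {y y′} → Chain (v , b) y → y′ ∈ T → OneOf (c y′) → Adjacent G y y′ → y ≢ y′ →
      Chain (v , b) y′
    chain-closed {y} {y′} ((z , k) , walk , exit@(y∈T , z-y , cy≡k)) y′∈T y′-colour (x , x-y , x-y′) y≢y′ =
      continue (endpoints y-joins x x-y)
      where
        o = proj₁ (other-end G z-y)
        y-joins = proj₂ (other-end G z-y)
        cy′≡ : c y′ ≡ swap k
        cy′≡ = OneOf-≢⇒swap (walk-OneOf (inj₂ refl) walk) y′-colour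
                 λ k≡cy′ → c-proper y y′ y≢y′ y∈T y′∈T (x , x-y , x-y′) (trans cy≡k k≡cy′)
        continue : x ≡ z ⊎ x ≡ o → Chain (v , b) y′
        continue (inj₂ refl) = (o , c y′) , walk ▷ (cy′≡ , y , exit , y-joins) , (y′∈T , x-y′ , refl)
        continue (inj₁ refl) with last-step walk
        ... | inj₁ refl = ⊥-elim (a-missing y′ y′∈T x-y′ (trans cy′≡ swap-b))
        ... | inj₂ (t′ , walk′ , (k≡ , y″ , exit″@(y″∈T , _ , cy″≡k′) , y″-joins)) =
          t′ , walk′ , subst (t′ exitsBy_) (sym y′≡y″) exit″
          where
            y′≡y″ : y′ ≡ y″
            y′≡y″ = same-colour⇒≡ G c-proper y′∈T y″∈T x-y′ (incident y″-joins)
                      (trans cy′≡ (trans (cong swap k≡) (trans (swap-involutive _) (sym cy″≡k′))))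

    recolour : (∀ y → Dec (Chain (v , b) y)) → Fin m → Fin 3
    recolour chain? y with chain? y
    ... | yes _ = swap (c y)
    ... | no  _ = c y

    recolour-proper : ∀ chain? → ProperOn G 3 T (recolour chain?)
    recolour-proper chain? y y′ y≢y′ y∈T y′∈T adj with chain? y | chain? y′
    ... | yes _      | yes _       = c-proper y y′ y≢y′ y∈T y′∈T adj ∘ swap-injective
    ... | no  _      | no  _       = c-proper y y′ y≢y′ y∈T y′∈T adj
    ... | yes y∈chain | no y′∉chain = λ swap-cy≡cy′ → y′∉chain
      (chain-closed y∈chain y′∈T
         (subst OneOf swap-cy≡cy′ (swap-OneOf (chain-OneOf (inj₂ refl) y∈chain)))
         adj y≢y′)
    ... | no y∉chain | yes y′∈chain = λ cy≡swap-cy′ → y∉chain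
      (chain-closed y′∈chain y∈T
         (subst OneOf (sym cy≡swap-cy′) (swap-OneOf (chain-OneOf (inj₂ refl) y′∈chain)))
         (adjacent-sym G adj) (≢-sym y≢y′))

module IrreducibleMatching
  (G : Graph) (subcubic : Subcubic G) (R : Subset (Graph.m G))
  (c : Fin (Graph.m G) → Fin 3) (c-proper : ProperOn G 3 (∁ R) c)
  (R-critical : ∀ e → e ∈ R → ¬ ColourableWithout G (R - e)) where
  open Graph G

  T : Subset m
  T = ∁ R

  ColourAt : Fin n → Fin 3 → Set
  ColourAt v k = ∃ λ y → y ∈ T × Incident G v y × c y ≡ k

  ∈R⇒≢∈T : ∀ {x y} → x ∈ R → y ∈ T → x ≢ y
  ∈R⇒≢∈T x∈R y∈T refl = Subsetₚ.x∈∁p⇒x∉p y∈T x∈R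

  colour-≢⇒≢ : ∀ {y y′ k k′} → c y ≡ k → c y′ ≡ k′ → k ≢ k′ → y ≢ y′
  colour-≢⇒≢ cy≡k cy′≡k′ k≢k′ refl = k≢k′ (trans (sym cy≡k) cy′≡k′)

  no-free-colour : ∀ {f} → f ∈ R → ∀ {c′} → ProperOn G 3 T c′ → ∀ k →
    ¬ (∀ y → y ∈ T → Adjacent G f y → c′ y ≢ k)
  no-free-colour {f} f∈R {c′} c′-proper k k-free = R-critical f f∈R (c″ , c″-proper)
    where
      c″ : Fin m → Fin 3
      c″ y with y ≟ f
      ... | yes _ = k
      ... | no  _ = c′ y
      ∈T : ∀ {x} → x ∈ ∁ (R - f) → x ≢ f → x ∈ T
      ∈T x∈ x≢f = Subsetₚ.x∉p⇒x∈∁p λ x∈R → Subsetₚ.x∈∁p⇒x∉p x∈ (Subsetₚ.x∈p∧x≢y⇒x∈p-y x∈R x≢f)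
      c″-proper : ProperOn G 3 (∁ (R - f)) c″
      c″-proper y y′ y≢y′ y∈ y′∈ adj with y ≟ f | y′ ≟ f
      ... | yes refl | yes refl = ⊥-elim (y≢y′ refl)
      ... | yes refl | no y′≢f  = k-free y′ (∈T y′∈ y′≢f) adj ∘ sym
      ... | no y≢f   | yes refl = k-free y (∈T y∈ y≢f) (adjacent-sym G adj)
      ... | no y≢f   | no y′≢f  = c′-proper y y′ y≢y′ (∈T y∈ y≢f) (∈T y′∈ y′≢f) adj

  colour-near-other-end : ∀ {f u v} → f ∈ R → Joins G f u v → ∀ k →
    (∀ y → y ∈ T → Incident G u y → c y ≢ k) → ¬ ¬ ColourAt v k
  colour-near-other-end {f} {u} {v} f∈R f-joins k k-absent-at-u k-absent-at-v =
    no-free-colour f∈R c-proper k λ y y∈T (z , z-f , z-y) → at (endpoints f-joins z z-f) y∈T z-y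
    where
      at : ∀ {z y} → z ≡ u ⊎ z ≡ v → y ∈ T → Incident G z y → c y ≢ k
      at (inj₁ refl) y∈T z-y = k-absent-at-u _ y∈T z-y
      at (inj₂ refl) y∈T z-y cy≡k = k-absent-at-v (_ , y∈T , z-y , cy≡k)

  T-edge-at-each-end : ∀ {f u v} → f ∈ R → Joins G f u v → ¬ ¬ (∃ λ y → y ∈ T × Incident G u y)
  T-edge-at-each-end f∈R f-joins no-T-edge =
    colour-near zero             λ (y₀ , y₀∈T , v-y₀ , cy₀) →
    colour-near (suc zero)       λ (y₁ , y₁∈T , v-y₁ , cy₁) →
    colour-near (suc (suc zero)) λ (y₂ , y₂∈T , v-y₂ , cy₂) →
    ¬four-incident G subcubic (incident f-joins) v-y₀ v-y₁ v-y₂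
      (∈R⇒≢∈T f∈R y₀∈T) (∈R⇒≢∈T f∈R y₁∈T) (∈R⇒≢∈T f∈R y₂∈T)
      (colour-≢⇒≢ cy₀ cy₁ λ ()) (colour-≢⇒≢ cy₀ cy₂ λ ()) (colour-≢⇒≢ cy₁ cy₂ λ ())
    where
      colour-near : ∀ k → ¬ ¬ ColourAt _ k
      colour-near k = colour-near-other-end f∈R f-joins k λ y y∈T u-y _ → no-T-edge (y , y∈T , u-y)

  unique-T-edge : ∀ {u e e′ g} → e ∈ R → e′ ∈ R → e ≢ e′ → Incident G u e → Incident G u e′ →
    g ∈ T → Incident G u g → ∀ y → y ∈ T → Incident G u y → y ≡ g
  unique-T-edge e∈R e′∈R e≢e′ u-e u-e′ g∈T u-g y y∈T u-y =
    decidable-stable (y ≟ _) λ y≢g →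
      ¬four-incident G subcubic u-e u-e′ u-g u-y e≢e′ (∈R⇒≢∈T e∈R g∈T) (∈R⇒≢∈T e∈R y∈T)
        (∈R⇒≢∈T e′∈R g∈T) (∈R⇒≢∈T e′∈R y∈T) (≢-sym y≢g)

  module SharedEnd {u g} (g∈T : g ∈ T) (u-g : Incident G u g)
                   (only-g : ∀ y → y ∈ T → Incident G u y → y ≡ g) where

    a b d : Fin 3
    a = c g
    b = punchIn a zero
    d = punchIn a (suc zero)

    b≢a : b ≢ a
    b≢a = Finₚ.punchInᵢ≢i a zero

    d≢a : d ≢ a
    d≢a = Finₚ.punchInᵢ≢i a (suc zero)

    b≢d : b ≢ d
    b≢d b≡d with Finₚ.punchIn-injective a zero (suc zero) b≡d
    ... | ()

    open Transposition a b (≢-sym b≢a)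
    open KempeChain G T c c-proper a b (≢-sym b≢a)

    xg : Fin n
    xg = proj₁ (other-end G u-g)

    g-joins : Joins G g u xg
    g-joins = proj₂ (other-end G u-g)

    colour-near-far-end : ∀ {f v} → f ∈ R → Joins G f u v → ∀ k → k ≢ a → ¬ ¬ ColourAt v k
    colour-near-far-end f∈R f-joins k k≢a = colour-near-other-end f∈R f-joins k λ y y∈T u-y cy≡k →
      k≢a (trans (sym cy≡k) (cong c (only-g y y∈T u-y)))

    a-missing : ∀ {f v} → f ∈ R → Incident G v f → ColourAt v b → ColourAt v d → MissingAt v
    a-missing f∈R v-f (p , p∈T , v-p , cp≡b) (r , r∈T , v-r , cr≡d) y y∈T v-y cy≡a =
      ¬four-incident G subcubic v-f v-y v-p v-r (∈R⇒≢∈T f∈R y∈T) (∈R⇒≢∈T f∈R p∈T) (∈R⇒≢∈T f∈R r∈T)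
        (colour-≢⇒≢ cy≡a cp≡b (≢-sym b≢a)) (colour-≢⇒≢ cy≡a cr≡d (≢-sym d≢a)) (colour-≢⇒≢ cp≡b cr≡d b≢d)

    -- g is the only edge of T at u, so the chain cannot reach u before traversing g.
    enters-g : ∀ {v} → v ≢ u → Chain (v , b) g → (v , b) ⟶* (xg , a)
    enters-g v≢u ((z , k) , walk , (_ , z-g , a≡k)) with endpoints g-joins z z-g
    ... | inj₂ refl = subst ((_ , b) ⟶*_) (cong (xg ,_) (sym a≡k)) walk
    ... | inj₁ refl with last-step walk
    ...   | inj₁ u,k≡v,b = ⊥-elim (v≢u (cong proj₁ (sym u,k≡v,b)))
    ...   | inj₂ (_ , _ , (k≡ , y , (y∈T , _ , cy≡k′) , y-joins)) = ⊥-elim (b≢a b≡a)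
      where
        b≡a : b ≡ a
        b≡a = trans (sym swap-a)
                (trans (cong swap (trans (sym (cong c (only-g y y∈T (incident y-joins)))) cy≡k′))
                       (trans (sym k≡) (sym a≡k)))

    g∈chain : ∀ {f v} → f ∈ R → Joins G f u v → MissingAt v → ColourAt v b → ¬ ¬ Chain (v , b) g
    g∈chain {f} {v} f∈R f-joins a-missing-v (p , p∈T , v-p , cp≡b) g∉chain =
      ¬¬-decide-all (Chain (v , b)) λ chain? →
        no-free-colour f∈R (recolour-proper a-missing-v chain?) b (b-free chain?)
      where
        b-free : ∀ chain? y → y ∈ T → Adjacent G f y → recolour a-missing-v chain? y ≢ b
        b-free chain? y y∈T (z , z-f , z-y) with endpoints f-joins z z-f | chain? y
        ... | inj₁ refl | yes y∈chain = ⊥-elim (g∉chain (subst (Chain (v , b)) (only-g y y∈T z-y) y∈chain))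
        ... | inj₁ refl | no _        = λ cy≡b → b≢a (trans (sym cy≡b) (cong c (only-g y y∈T z-y)))
        ... | inj₂ refl | yes _       = λ swap-cy≡b →
          a-missing-v y y∈T z-y (trans (swap-sym swap-cy≡b) swap-b)
        ... | inj₂ refl | no y∉chain  = λ cy≡b → y∉chain (subst (Chain (v , b))
          (same-colour⇒≡ G c-proper p∈T y∈T v-p z-y (trans cp≡b (sym cy≡b))) (_ , ε , (p∈T , v-p , cp≡b)))

    far-ends-absurd : ∀ {e e′ v w} → e ∈ R → e′ ∈ R → e ≢ e′ → Joins G e u v → Joins G e′ u w →
      ColourAt v b → ColourAt v d → ColourAt w b → ColourAt w d → ⊥
    far-ends-absurd {v = v} {w} e∈R e′∈R e≢e′ e-joins e′-joins
                    bv@(p , p∈T , v-p , cp≡b) dv@(r , r∈T , v-r , cr≡d) bw dw with v ≟ w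
    ... | yes refl =
      ¬four-incident G subcubic (incident e-joins) (incident e′-joins) v-p v-r e≢e′
        (∈R⇒≢∈T e∈R p∈T) (∈R⇒≢∈T e∈R r∈T) (∈R⇒≢∈T e′∈R p∈T) (∈R⇒≢∈T e′∈R r∈T) (colour-≢⇒≢ cp≡b cr≡d b≢d)
    ... | no v≢w =
      g∈chain e∈R e-joins missing-v bv λ g∈chain-v →
      g∈chain e′∈R e′-joins missing-w bw λ g∈chain-w →
      v≢w (cong proj₁ (initial-unique (initial missing-v) (initial missing-w)
             (enters-g (distinct e-joins) g∈chain-v) (enters-g (distinct e′-joins) g∈chain-w)))
      where
        missing-v = a-missing e∈R (incident e-joins) bv dv
        missing-w = a-missing e′∈R (incident e′-joins) bw dw

    shared-end-absurd : ∀ {e e′ v w} → e ∈ R → e′ ∈ R → e ≢ e′ → Joins G e u v → Joins G e′ u w → ⊥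
    shared-end-absurd e∈R e′∈R e≢e′ e-joins e′-joins =
      colour-near-far-end e∈R  e-joins  b b≢a λ bv →
      colour-near-far-end e∈R  e-joins  d d≢a λ dv →
      colour-near-far-end e′∈R e′-joins b b≢a λ bw →
      colour-near-far-end e′∈R e′-joins d d≢a λ dw →
      far-ends-absurd e∈R e′∈R e≢e′ e-joins e′-joins bv dv bw dw

  R-matching : Matching G R
  R-matching e e′ e≢e′ e∈R e′∈R (u , u-e , u-e′) =
    T-edge-at-each-end e∈R e-joins λ (g , g∈T , u-g) →
      SharedEnd.shared-end-absurd g∈T u-g (unique-T-edge e∈R e′∈R e≢e′ u-e u-e′ g∈T u-g)
        e∈R e′∈R e≢e′ e-joins (proj₂ (other-end G u-e′))
    where
      e-joins = proj₂ (other-end G u-e)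

irreducible⇒matching : ∀ G → Subcubic G → ∀ {R} → Irreducible (ColourableWithout G) R → Matching G R
irreducible⇒matching G subcubic ((c , c-proper) , R-critical) =
  IrreducibleMatching.R-matching G subcubic _ c c-proper R-critical

module _ (G : Graph) (subcubic : Subcubic G) where

  irreducible⇒colourClass : ∀ {R} → Irreducible (ColourableWithout G) R →
    ∃ λ f → Proper G 4 f × colourClass G f zero ≡ R
  irreducible⇒colourClass {R} R-irreducible@((c , c-proper) , _) =
    extend G R c ,
    extend-proper G (irreducible⇒matching G subcubic R-irreducible) c-proper ,
    colourClass-extend G R c

  colourClass-minimum : ∀ {f} → MinimalColouring G f → MinimumRepresentative G (colourClass G f zero)
  colourClass-minimum {f} (f-proper , f-minimal) =
    colourableWithout⇒representative G (∁colourClass-colourable G f-proper zero) , smallest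
    where
      smallest : ∀ R → RepresentativeConflicting G R → ∣ colourClass G f zero ∣ ≤ ∣ R ∣
      smallest R R-representative =
        let S , S⊆R , S-irreducible =
              irreducible-⊆ (colourable? G ∘ ∁) (representative⇒colourableWithout G R-representative)
            g , g-proper , class≡S = irreducible⇒colourClass S-irreducible
        in ℕₚ.≤-trans (f-minimal g g-proper zero)
             (subst (λ X → ∣ X ∣ ≤ ∣ R ∣) (sym class≡S) (Subsetₚ.p⊆q⇒∣p∣≤∣q∣ S⊆R))

  minimum⇒colourClass : ∀ {R} → MinimumRepresentative G R →
    ∃ λ f → MinimalColouring G f × colourClass G f zero ≡ R
  minimum⇒colourClass R-minimum@(_ , smallest) =
    let f , f-proper , class≡R = irreducible⇒colourClass (minimum⇒irreducible G R-minimum)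
    in f , (f-proper , λ g g-proper i → subst (λ X → ∣ X ∣ ≤ _) (sym class≡R)
              (smallest _ (colourableWithout⇒representative G (∁colourClass-colourable G g-proper i))))
         , class≡R

theorem2p8 : (G : Graph) → Subcubic G → ClassTwo G →
    ∀ (e : Fin (Graph.m G)) →
      InCritical G e ⇔ (∃ λ R → MinimumRepresentative G R × e ∈ R)
theorem2p8 G subcubic _ e = mk⇔
  (λ (f , f-minimal , fe≡0) →
    colourClass G f zero , colourClass-minimum G subcubic f-minimal , ∈colourClass⁺ G {f = f} fe≡0)
  (λ (R , R-minimum , e∈R) →
    let f , f-minimal , class≡R = minimum⇒colourClass G subcubic R-minimum
    in f , f-minimal , ∈colourClass⁻ G {f = f} (subst (e ∈_) (sym class≡R) e∈R))
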